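{- Let $p$ be an odd prime and $d$ a positive integer not divisible by $p$. For an integer $1<J<p$ let \[C_J=\left\{i'\in\mathbb{Z}\ \middle|\ 0<i'<\tfrac{(p-J)d}{p},\ p\nmid i'\right\},\] \[R_J=\left\{(i,\lambda)\in\mathbb{Z}^2\ \middle|\ 0<\lambda<J,\ \tfrac{(p\lambda-J+1)d}{p^2}<i<\tfrac{(p(\lambda+1)-J)d}{p^2}\right\}.\] Then (1) if $1<J\le(p+1)/2$, $|R_J|\le|C_J|$; (2) if $(p+1)/2\le J<p$, $|C_J|\le|R_J|$. -}

module Defs where

open import Data.Nat using (ℕ; zero; suc; _+_; _*_; _∸_; _<_; _<?_)
open import Data.Nat.Divisibility using (_∣_; _∣?_)
open import Data.List using (List; length; filter; upTo; concatMap; map)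
open import Data.Product using (_×_; _,_)
open import Relation.Nullary using (¬_)
open import Relation.Nullary.Decidable using (_×-dec_; ¬?)

-- Every such i' is a natural number with i' < (p-J)d/p ≤ d, so we enumerate
-- candidates i' ∈ {0,…,d} and filter by the exact defining conditions
-- (0 < i', p·i' < (p-J)·d, ¬ p ∣ i').
CJ : (p d J : ℕ) → List ℕ
CJ p d J = filter (λ i → (0 <? i) ×-dec ((p * i) <? ((p ∸ J) * d)) ×-dec ¬? (p ∣? i))
                  (upTo (suc d))

-- For 1 < J < p and 0 < λ, the lower bound (pλ-J+1)d/p² is positive, so i > 0,
-- and the upper bound is < d; hence enumerating λ ∈ {0,…,J-1}, i ∈ {0,…,d}
-- and filtering by the exact conditions gives the set.  (In that range the
-- truncated subtractions below coincide with integer subtraction: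
-- pλ+1 ≥ J and p(λ+1) ≥ J.)
RJ : (p d J : ℕ) → List (ℕ × ℕ)
RJ p d J = filter
  (λ { (i , l) → (0 <? l) ×-dec (l <? J)
                 ×-dec ((((p * l + 1) ∸ J) * d) <? (p * p * i))
                 ×-dec ((p * p * i) <? ((p * (l + 1) ∸ J) * d)) })
  (concatMap (λ l → map (λ i → (i , l)) (upTo (suc d))) (upTo J))

{-# OPTIONS --safe #-}
-- Both sets are compared through the offset k = |p i - λ d| of a point (i, λ).
-- Multiplying the window for i by p shows that, for 0 < λ < J, (i, λ) ∈ R_J says exactly
-- that the signed offset p i - λ d lies strictly between -(J - 1) d / p and (p - J) d / p;
-- it is never divisible by p, since p ∤ λ d.
-- If 2J ≤ p + 1 then J - 1 ≤ p - J, so the offset lands in C_J, and it is injective on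
-- R_J: equal offsets of the same sign force λ ≡ λ' (mod p), while opposite signs give
-- p ∣ (λ + λ') d with 0 < λ + λ' < p.
-- If 2J ≥ p + 1, every k ∈ C_J is an offset: pick λ < p with p ∣ k + λ d (d is
-- invertible mod p) and i = (k + λ d) / p; if λ ≥ J replace (i, λ) by (d - i, p - λ),
-- whose offset is -k, and which lies in R_J because J - 1 ≥ p - J.
module Submission where

open import Defs
open import Data.Nat
open import Data.Nat.Properties
open import Data.Nat.Divisibility
open import Data.Nat.DivMod using (_%_; _/_; m≡m%n+[m/n]*n; m%n<n)
open import Data.Nat.Primality using (Prime; prime⇒irreducible; prime⇒nonZero)
open import Data.Nat.Coprimality
  using (Coprime; coprime-Bézout; coprime-divisor; prime⇒coprime)
open import Data.Nat.GCD using (module Bézout)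
open import Data.Nat.Tactic.RingSolver using (solve-∀; solve)
open import Data.Fin using (Fin)
open import Data.Fin.Properties using (injective⇒≤)
open import Data.List
  using (List; []; _∷_; length; lookup; map; concatMap; cartesianProductWith; _++_; upTo)
open import Data.List.Relation.Unary.Any using (index)
open import Data.List.Relation.Unary.Any.Properties using (lookup-index)
import Data.List.Relation.Unary.All as All
open import Data.List.Relation.Unary.AllPairs using (_∷_)
open import Data.List.Relation.Unary.Unique.Propositional using (Unique)
open import Data.List.Relation.Unary.Unique.Propositional.Properties
  using (filter⁺; upTo⁺; cartesianProductWith⁺)
open import Data.List.Membership.Propositional using (_∈_)
open import Data.List.Membership.Propositional.Properties
  using (∈-lookup; ∈-filter⁺; ∈-filter⁻; ∈-upTo⁺; ∈-cartesianProductWith⁺)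
open import Data.Product using (_×_; _,_; proj₁; proj₂; ∃-syntax)
open import Data.Sum using (_⊎_; inj₁; inj₂)
open import Function using (_∘_; flip; _⇔_; mk⇔; Equivalence)
open import Function.Definitions using (Injective)
open import Relation.Binary.Definitions using (tri<; tri≈; tri>)
open import Relation.Binary.PropositionalEquality
open import Algebra.Properties.CommutativeSemigroup +-commutativeSemigroup
  using (xy∙z≈xz∙y)
open import Relation.Nullary using (¬_; Dec; yes; no; contradiction)
open import Relation.Nullary.Decidable using (_×-dec_; ¬?)
open import Relation.Unary using (Decidable)

lookup-injective : ∀ {a} {A : Set a} {xs : List A} {i j : Fin (length xs)} →
                   Unique xs → lookup xs i ≡ lookup xs j → i ≡ j
lookup-injective {xs = _ ∷ _} {Fin.zero}  {Fin.zero}  _          _  = refl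
lookup-injective {xs = _ ∷ _} {Fin.zero}  {Fin.suc j} (x∉ ∷ _)   eq =
  contradiction eq (All.lookup x∉ (∈-lookup j))
lookup-injective {xs = _ ∷ _} {Fin.suc i} {Fin.zero}  (x∉ ∷ _)   eq =
  contradiction (sym eq) (All.lookup x∉ (∈-lookup i))
lookup-injective {xs = _ ∷ _} {Fin.suc i} {Fin.suc j} (_ ∷ uniq) eq =
  cong Fin.suc (lookup-injective uniq eq)

injection⇒length≤ : ∀ {a b r} {A : Set a} {B : Set b} {xs : List A} {ys : List B}
                    (R : A → B → Set r) → Unique xs →
                    (∀ {x} → x ∈ xs → ∃[ y ] y ∈ ys × R x y) →
                    (∀ {x x′ y} → x ∈ xs → x′ ∈ xs →
                                  R x y → R x′ y → x ≡ x′) →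
                    length xs ≤ length ys
injection⇒length≤ {xs = xs} {ys} R uniq image injective = injective⇒≤ position-injective
  where
  position : Fin (length xs) → Fin (length ys)
  position i = index (proj₁ (proj₂ (image (∈-lookup i))))

  position-injective : Injective _≡_ _≡_ position
  position-injective {i} {j} eq = lookup-injective uniq
    (injective (∈-lookup i) (∈-lookup j) Rᵢ (subst (R (lookup xs j)) (sym yᵢ≡yⱼ) Rⱼ))
    where
    yᵢ : ∃[ y ] y ∈ ys × R (lookup xs i) y
    yᵢ = image (∈-lookup i)
    yⱼ : ∃[ y ] y ∈ ys × R (lookup xs j) y
    yⱼ = image (∈-lookup j)
    Rᵢ : R (lookup xs i) (proj₁ yᵢ)
    Rᵢ = proj₂ (proj₂ yᵢ)
    Rⱼ : R (lookup xs j) (proj₁ yⱼ)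
    Rⱼ = proj₂ (proj₂ yⱼ)
    yᵢ≡yⱼ : proj₁ yᵢ ≡ proj₁ yⱼ
    yᵢ≡yⱼ = trans (lookup-index (proj₁ (proj₂ yᵢ)))
              (trans (cong (lookup ys) eq) (sym (lookup-index (proj₁ (proj₂ yⱼ)))))

concatMap-map≡cartesianProductWith : ∀ {a b c} {A : Set a} {B : Set b} {C : Set c}
  (f : A → B → C) xs ys → concatMap (λ x → map (f x) ys) xs ≡ cartesianProductWith f xs ys
concatMap-map≡cartesianProductWith f []       ys = refl
concatMap-map≡cartesianProductWith f (x ∷ xs) ys =
  cong (map (f x) ys ++_) (concatMap-map≡cartesianProductWith f xs ys)

Gap : ℕ → ℕ → ℕ → Set
Gap m n k = k + n ≡ m ⊎ k + m ≡ n

gap-∣-∣ : ∀ m n → Gap m n ∣ m - n ∣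
gap-∣-∣ m n with ≤-total n m
... | inj₁ n≤m = inj₁ (trans (cong (_+ n) (m≤n⇒∣n-m∣≡n∸m n≤m)) (m∸n+n≡m n≤m))
... | inj₂ m≤n = inj₂ (trans (cong (_+ m) (m≤n⇒∣m-n∣≡n∸m m≤n)) (m∸n+n≡m m≤n))

gap⇒∣-∣ : ∀ {m n k} → Gap m n k → ∣ m - n ∣ ≡ k
gap⇒∣-∣ {n = n} {k} (inj₁ refl) =
  trans (cong (∣_- n ∣) (+-comm k n)) (trans (∣-∣-comm (n + k) n) (∣m-m+n∣≡n n k))
gap⇒∣-∣ {m = m} {k = k} (inj₂ refl) =
  trans (cong (∣ m -_∣) (+-comm k m)) (∣m-m+n∣≡n m k)

gap-cases : ∀ {m n m′ n′ k} → Gap m n k → Gap m′ n′ k →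
            m + n′ ≡ m′ + n ⊎ m + m′ ≡ n + n′
gap-cases {m} {n} {m′} {n′} {k} (inj₁ refl) (inj₁ refl) = inj₁ (solve (k ∷ n ∷ n′ ∷ []))
gap-cases {m} {n} {m′} {n′} {k} (inj₁ refl) (inj₂ refl) = inj₂ (solve (k ∷ n ∷ m′ ∷ []))
gap-cases {m} {n} {m′} {n′} {k} (inj₂ refl) (inj₁ refl) = inj₂ (solve (k ∷ m ∷ n′ ∷ []))
gap-cases {m} {n} {m′} {n′} {k} (inj₂ refl) (inj₂ refl) = inj₁ (solve (k ∷ m ∷ m′ ∷ []))

gap-functional : ∀ {m n k k′} → Gap m n k → Gap m n k′ → k ≡ k′
gap-functional gap gap′ = trans (sym (gap⇒∣-∣ gap)) (gap⇒∣-∣ gap′)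

k+ld≡pq⇒k+p[d∸q]≡[p∸l]d : ∀ {k l d p q} → l ≤ p → q ≤ d →
                           k + l * d ≡ p * q → k + p * (d ∸ q) ≡ (p ∸ l) * d
k+ld≡pq⇒k+p[d∸q]≡[p∸l]d {k} {l} {d} {p} {q} l≤p q≤d k+ld≡pq =
  +-cancelʳ-≡ (l * d) _ _ (begin
  k + p * (d ∸ q) + l * d ≡⟨ xy∙z≈xz∙y k (p * (d ∸ q)) (l * d) ⟩
  k + l * d + p * (d ∸ q) ≡⟨ cong (_+ p * (d ∸ q)) k+ld≡pq ⟩
  p * q + p * (d ∸ q)     ≡⟨ *-distribˡ-+ p q (d ∸ q) ⟨
  p * (q + (d ∸ q))       ≡⟨ cong (p *_) (m+[n∸m]≡n q≤d) ⟩
  p * d                   ≡⟨ cong (_* d) (m∸n+n≡m l≤p) ⟨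
  (p ∸ l + l) * d         ≡⟨ *-distribʳ-+ d (p ∸ l) l ⟩
  (p ∸ l) * d + l * d     ∎)
  where open ≡-Reasoning

module _ {p d : ℕ} (p-prime : Prime p) (p∤d : ¬ p ∣ d) where

  p∤*d : ∀ {a} → 0 < a → a < p → ¬ p ∣ a * d
  p∤*d a>0 a<p = p∤d ∘ coprime-divisor (prime⇒coprime p-prime {{>-nonZero a>0}} a<p)

  private
    p*x+a*d≢p*y+b*d : ∀ {x y a b} → a < b → b < p → p * x + a * d ≢ p * y + b * d
    p*x+a*d≢p*y+b*d {x} {y} {a} {b} a<b b<p eq =
      p∤*d (m<n⇒0<n∸m a<b) (≤-<-trans (m∸n≤m b a) b<p)
        (∣m+n∣m⇒∣n (subst (p ∣_) px≡py+[b∸a]d (m∣m*n x)) (m∣m*n y))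
      where
      open ≡-Reasoning
      px≡py+[b∸a]d : p * x ≡ p * y + (b ∸ a) * d
      px≡py+[b∸a]d = +-cancelʳ-≡ (a * d) _ _ (begin
        p * x + a * d                 ≡⟨ eq ⟩
        p * y + b * d                 ≡⟨ cong (λ t → p * y + t * d) (m∸n+n≡m (<⇒≤ a<b)) ⟨
        p * y + (b ∸ a + a) * d       ≡⟨ cong (p * y +_) (*-distribʳ-+ d (b ∸ a) a) ⟩
        p * y + ((b ∸ a) * d + a * d) ≡⟨ +-assoc (p * y) _ _ ⟨
        p * y + (b ∸ a) * d + a * d   ∎)

  p*x+a*d-injective : ∀ {x y a b} → a < p → b < p →
                      p * x + a * d ≡ p * y + b * d → x ≡ y × a ≡ b
  p*x+a*d-injective {x} {y} {a} {b} a<p b<p eq with <-cmp a b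
  ... | tri< a<b _ _ = contradiction eq (p*x+a*d≢p*y+b*d a<b b<p)
  ... | tri> _ _ b<a = contradiction (sym eq) (p*x+a*d≢p*y+b*d b<a a<p)
  ... | tri≈ _ refl _ =
    *-cancelˡ-≡ x y p {{prime⇒nonZero p-prime}} (+-cancelʳ-≡ (a * d) _ _ eq) , refl

prime∧∤⇒coprime : ∀ {p n} → Prime p → ¬ p ∣ n → Coprime p n
prime∧∤⇒coprime p-prime p∤n (i∣p , i∣n) with prime⇒irreducible p-prime i∣p
... | inj₁ i≡1 = i≡1
... | inj₂ refl = contradiction i∣n p∤n

∃-negative-inverse : ∀ {p d} .{{_ : NonZero p}} → Coprime p d → ∃[ y ] p ∣ 1 + y * d
∃-negative-inverse {suc p′} {d} coprime with coprime-Bézout coprime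
... | Bézout.+- x y 1+yd≡xp = y , divides x 1+yd≡xp
... | Bézout.-+ x y 1+xp≡yd = p′ * y , divides (1 + p′ * x) (begin
  1 + p′ * y * d            ≡⟨ cong (1 +_) (*-assoc p′ y d) ⟩
  1 + p′ * (y * d)          ≡⟨ cong (λ t → 1 + p′ * t) 1+xp≡yd ⟨
  1 + p′ * (1 + x * suc p′) ≡⟨ solve (p′ ∷ x ∷ []) ⟩
  (1 + p′ * x) * suc p′     ∎)
  where open ≡-Reasoning

∣k+m*d⇒∣k+[m%p]*d : ∀ {p} .{{_ : NonZero p}} k m d → p ∣ k + m * d → p ∣ k + m % p * d
∣k+m*d⇒∣k+[m%p]*d {p} k m d p∣k+md =
  ∣m+n∣m⇒∣n (subst (p ∣_) k+md≡ p∣k+md) (n∣m*n*o (m / p) d)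
  where
  regroup : ∀ k r s d → k + (r + s) * d ≡ s * d + (k + r * d)
  regroup = solve-∀
  k+md≡ : k + m * d ≡ m / p * p * d + (k + m % p * d)
  k+md≡ = trans (cong (λ t → k + t * d) (m≡m%n+[m/n]*n m p))
                (regroup k (m % p) (m / p * p) d)

∃-residue : ∀ {p d} .{{_ : NonZero p}} → Coprime p d → ∀ k → ∃[ l ] l < p × p ∣ k + l * d
∃-residue {p} {d} coprime k with y , p∣1+yd ← ∃-negative-inverse coprime =
  k * y % p , m%n<n (k * y) p , ∣k+m*d⇒∣k+[m%p]*d k (k * y) d
    (subst (p ∣_) {k * (1 + y * d)} (solve (k ∷ y ∷ d ∷ [])) (∣n⇒∣m*n k p∣1+yd))

module Conditions (p d J : ℕ) where

  CJ-Condition : ℕ → Set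
  CJ-Condition k = 0 < k × p * k < (p ∸ J) * d × ¬ p ∣ k

  lowerEnd upperEnd : ℕ → ℕ
  lowerEnd l = (p * l + 1 ∸ J) * d
  upperEnd l = (p * (l + 1) ∸ J) * d

  RJ-Condition : ℕ × ℕ → Set
  RJ-Condition (i , l) = 0 < l × l < J × lowerEnd l < p * p * i × p * p * i < upperEnd l

  CJ-condition? : Decidable CJ-Condition
  CJ-condition? k = (0 <? k) ×-dec (p * k <? (p ∸ J) * d) ×-dec ¬? (p ∣? k)

  RJ-condition? : Decidable RJ-Condition
  RJ-condition? (i , l) = (0 <? l) ×-dec (l <? J)
    ×-dec (lowerEnd l <? p * p * i) ×-dec (p * p * i <? upperEnd l)

  private
    swap : ℕ → ℕ → ℕ × ℕ
    swap l i = i , l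

    pairs : List (ℕ × ℕ)
    pairs = concatMap (λ l → map (swap l) (upTo (suc d))) (upTo J)

    pairs≡ : pairs ≡ cartesianProductWith swap (upTo J) (upTo (suc d))
    pairs≡ = concatMap-map≡cartesianProductWith swap (upTo J) (upTo (suc d))

  CJ-unique : Unique (CJ p d J)
  CJ-unique = filter⁺ CJ-condition? (upTo⁺ (suc d))

  RJ-unique : Unique (RJ p d J)
  RJ-unique = filter⁺ RJ-condition? (subst Unique (sym pairs≡)
    (cartesianProductWith⁺ swap (λ { refl → refl , refl }) (upTo⁺ J) (upTo⁺ (suc d))))

  ∈CJ⁻ : ∀ {k} → k ∈ CJ p d J → CJ-Condition k
  ∈CJ⁻ = proj₂ ∘ ∈-filter⁻ CJ-condition? {xs = upTo (suc d)}

  p*k<[p∸J]*d⇒k<d : ∀ {k} → p * k < (p ∸ J) * d → k < d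
  p*k<[p∸J]*d⇒k<d {k} pk<[p∸J]d =
    *-cancelˡ-< p k d (<-≤-trans pk<[p∸J]d (*-monoˡ-≤ d (m∸n≤m p J)))

  ∈CJ⁺ : ∀ {k} → CJ-Condition k → k ∈ CJ p d J
  ∈CJ⁺ cond@(_ , pk<[p∸J]d , _) =
    ∈-filter⁺ CJ-condition? (∈-upTo⁺ (m<n⇒m<1+n (p*k<[p∸J]*d⇒k<d pk<[p∸J]d))) cond

  ∈RJ⁻ : ∀ {i l} → (i , l) ∈ RJ p d J → RJ-Condition (i , l)
  ∈RJ⁻ = proj₂ ∘ ∈-filter⁻ RJ-condition? {xs = pairs}

  ∈RJ⁺ : ∀ {i l} → i ≤ d → RJ-Condition (i , l) → (i , l) ∈ RJ p d J
  ∈RJ⁺ i≤d cond@(_ , l<J , _) = ∈-filter⁺ RJ-condition? (subst (_ ∈_) (sym pairs≡)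
    (∈-cartesianProductWith⁺ swap (∈-upTo⁺ l<J) (∈-upTo⁺ (s≤s i≤d)))) cond

module OffsetMap {p d J : ℕ} (p-prime : Prime p) (d>0 : 0 < d) (p∤d : ¬ p ∣ d)
               (1<J : 1 < J) (J<p : J < p) where

  open Conditions p d J

  j : ℕ
  j = p ∸ J

  J+j≡p : J + j ≡ p
  J+j≡p = m+[n∸m]≡n (<⇒≤ J<p)

  Offset : ℕ × ℕ → ℕ → Set
  Offset (i , l) k = Gap (p * i) (l * d) k

  upperEnd≡ : ∀ l → upperEnd l ≡ p * (l * d) + j * d
  upperEnd≡ l = begin
    (p * (l + 1) ∸ J) * d ≡⟨ cong (λ t → (t ∸ J) * d) (solve (p ∷ l ∷ [])) ⟩
    (p * l + p ∸ J) * d   ≡⟨ cong (_* d) (+-∸-assoc (p * l) (<⇒≤ J<p)) ⟩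
    (p * l + j) * d       ≡⟨ *-distribʳ-+ d (p * l) j ⟩
    p * l * d + j * d     ≡⟨ cong (_+ j * d) (*-assoc p l d) ⟩
    p * (l * d) + j * d   ∎
    where open ≡-Reasoning

  lowerEnd+Jd≡ : ∀ {l} → 0 < l → lowerEnd l + J * d ≡ p * (l * d) + d
  lowerEnd+Jd≡ {l} l>0 = begin
    (p * l + 1 ∸ J) * d + J * d ≡⟨ *-distribʳ-+ d (p * l + 1 ∸ J) J ⟨
    (p * l + 1 ∸ J + J) * d     ≡⟨ cong (_* d) (m∸n+n≡m J≤pl+1) ⟩
    (p * l + 1) * d             ≡⟨ solve (p ∷ l ∷ d ∷ []) ⟩
    p * (l * d) + d             ∎
    where
    open ≡-Reasoning
    J≤pl+1 : J ≤ p * l + 1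
    J≤pl+1 = ≤-trans (<⇒≤ J<p) (≤-trans (m≤m*n p l {{>-nonZero l>0}}) (m≤m+n (p * l) 1))

  private
    p*p*i-above : ∀ {i l k} → k + l * d ≡ p * i → p * p * i ≡ p * (l * d) + p * k
    p*p*i-above {i} {l} {k} k+ld≡pi = begin
      p * p * i           ≡⟨ *-assoc p p i ⟩
      p * (p * i)         ≡⟨ cong (p *_) k+ld≡pi ⟨
      p * (k + l * d)     ≡⟨ *-distribˡ-+ p k (l * d) ⟩
      p * k + p * (l * d) ≡⟨ +-comm (p * k) _ ⟩
      p * (l * d) + p * k ∎
      where open ≡-Reasoning

    p*l*d-below : ∀ {i l k} → k + p * i ≡ l * d → p * (l * d) ≡ p * p * i + p * k
    p*l*d-below {i} {l} {k} k+pi≡ld = begin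
      p * (l * d)         ≡⟨ cong (p *_) k+pi≡ld ⟨
      p * (k + p * i)     ≡⟨ *-distribˡ-+ p k (p * i) ⟩
      p * k + p * (p * i) ≡⟨ +-comm (p * k) _ ⟩
      p * (p * i) + p * k ≡⟨ cong (_+ p * k) (*-assoc p p i) ⟨
      p * p * i + p * k   ∎
      where open ≡-Reasoning

  above-lowerEnd : ∀ {i l k} → 0 < l → k + l * d ≡ p * i → lowerEnd l < p * p * i
  above-lowerEnd {i} {l} {k} l>0 k+ld≡pi = +-cancelʳ-< (J * d) _ _ (begin-strict
    lowerEnd l + J * d          ≡⟨ lowerEnd+Jd≡ {l} l>0 ⟩
    p * (l * d) + d             <⟨ +-monoʳ-< (p * (l * d)) d<Jd ⟩
    p * (l * d) + J * d         ≤⟨ +-monoˡ-≤ (J * d) (m≤m+n (p * (l * d)) (p * k)) ⟩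
    p * (l * d) + p * k + J * d ≡⟨ cong (_+ J * d) (p*p*i-above {l = l} k+ld≡pi) ⟨
    p * p * i + J * d           ∎)
    where
    open ≤-Reasoning
    d<Jd : d < J * d
    d<Jd = subst (_< J * d) (*-identityˡ d) (*-monoˡ-< d {{>-nonZero d>0}} 1<J)

  above-upperEnd⇔ : ∀ {i l k} → k + l * d ≡ p * i → (p * p * i < upperEnd l ⇔ p * k < j * d)
  above-upperEnd⇔ {i} {l} {k} k+ld≡pi = mk⇔
    (λ upper → +-cancelˡ-< (p * (l * d)) _ _ (subst₂ _<_ p²i≡ (upperEnd≡ l) upper))
    (λ pk<jd → subst₂ _<_ (sym p²i≡) (sym (upperEnd≡ l)) (+-monoʳ-< (p * (l * d)) pk<jd))
    where
    p²i≡ : p * p * i ≡ p * (l * d) + p * k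
    p²i≡ = p*p*i-above {l = l} k+ld≡pi

  below-upperEnd : ∀ {i l k} → k + p * i ≡ l * d → p * p * i < upperEnd l
  below-upperEnd {i} {l} {k} k+pi≡ld = begin-strict
    p * p * i           ≤⟨ m≤m+n (p * p * i) (p * k) ⟩
    p * p * i + p * k   ≡⟨ p*l*d-below {l = l} k+pi≡ld ⟨
    p * (l * d)         <⟨ m<m+n (p * (l * d)) (*-monoˡ-< d {{>-nonZero d>0}} (m<n⇒0<n∸m J<p)) ⟩
    p * (l * d) + j * d ≡⟨ upperEnd≡ l ⟨
    upperEnd l          ∎
    where open ≤-Reasoning

  below-lowerEnd⇔ : ∀ {i l k} → 0 < l → k + p * i ≡ l * d →
                    (lowerEnd l < p * p * i ⇔ p * k + d < J * d)
  below-lowerEnd⇔ {i} {l} {k} l>0 k+pi≡ld = mk⇔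
    (λ lower → +-cancelˡ-< (p * p * i) _ _
                 (subst (_< p * p * i + J * d) ends≡ (+-monoˡ-< (J * d) lower)))
    (λ pk+d<Jd → +-cancelʳ-< (J * d) _ _
                   (subst (_< p * p * i + J * d) (sym ends≡) (+-monoʳ-< (p * p * i) pk+d<Jd)))
    where
    open ≡-Reasoning
    ends≡ : lowerEnd l + J * d ≡ p * p * i + (p * k + d)
    ends≡ = begin
      lowerEnd l + J * d      ≡⟨ lowerEnd+Jd≡ {l} l>0 ⟩
      p * (l * d) + d         ≡⟨ cong (_+ d) (p*l*d-below {l = l} k+pi≡ld) ⟩
      p * p * i + p * k + d   ≡⟨ +-assoc (p * p * i) (p * k) d ⟩
      p * p * i + (p * k + d) ∎

  2J≤p+1⇒J≤1+j : 2 * J ≤ p + 1 → J ≤ suc j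
  2J≤p+1⇒J≤1+j 2J≤p+1 = +-cancelˡ-≤ J J (suc j) (begin
    J + J         ≡⟨ cong (J +_) (+-identityʳ J) ⟨
    2 * J         ≤⟨ 2J≤p+1 ⟩
    p + 1         ≡⟨ cong (_+ 1) J+j≡p ⟨
    J + j + 1     ≡⟨ +-comm (J + j) 1 ⟩
    suc (J + j)   ≡⟨ +-suc J j ⟨
    J + suc j     ∎)
    where open ≤-Reasoning

  p+1≤2J⇒1+j≤J : p + 1 ≤ 2 * J → suc j ≤ J
  p+1≤2J⇒1+j≤J p+1≤2J = +-cancelˡ-≤ J (suc j) J (begin
    J + suc j     ≡⟨ +-suc J j ⟩
    suc (J + j)   ≡⟨ +-comm (J + j) 1 ⟨
    J + j + 1     ≡⟨ cong (_+ 1) J+j≡p ⟩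
    p + 1         ≤⟨ p+1≤2J ⟩
    2 * J         ≡⟨ cong (J +_) (+-identityʳ J) ⟩
    J + J         ∎)
    where open ≤-Reasoning

  offset-CJ-Condition : J ≤ suc j → ∀ {x k} → RJ-Condition x → Offset x k → CJ-Condition k
  offset-CJ-Condition J≤1+j {i , l} {k} (l>0 , l<J , lower , upper) gap =
    n≢0⇒n>0 k≢0 , pk<jd gap , p∤k
    where
    p∤k : ¬ p ∣ k
    p∤k p∣k = p∤*d p-prime p∤d l>0 (<-trans l<J J<p) (p∣ld gap)
      where
      p∣ld : Offset (i , l) k → p ∣ l * d
      p∣ld (inj₁ k+ld≡pi) = ∣m+n∣m⇒∣n (subst (p ∣_) (sym k+ld≡pi) (m∣m*n i)) p∣k
      p∣ld (inj₂ k+pi≡ld) = subst (p ∣_) k+pi≡ld (∣m∣n⇒∣m+n p∣k (m∣m*n i))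

    k≢0 : k ≢ 0
    k≢0 refl = p∤k (p ∣0)

    pk<jd : Offset (i , l) k → p * k < j * d
    pk<jd (inj₁ k+ld≡pi) = Equivalence.to (above-upperEnd⇔ {l = l} k+ld≡pi) upper
    pk<jd (inj₂ k+pi≡ld) = +-cancelʳ-< d (p * k) (j * d) (begin-strict
      p * k + d <⟨ Equivalence.to (below-lowerEnd⇔ l>0 k+pi≡ld) lower ⟩
      J * d     ≤⟨ *-monoˡ-≤ d J≤1+j ⟩
      suc j * d ≡⟨ +-comm d (j * d) ⟩
      j * d + d ∎)
      where open ≤-Reasoning

  offset-injective : J ≤ suc j → ∀ {x x′ k} → RJ-Condition x → RJ-Condition x′ →
                     Offset x k → Offset x′ k → x ≡ x′
  offset-injective J≤1+j {i , l} {i′ , l′} (l>0 , l<J , _) (_ , l′<J , _) gap gap′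
    with gap-cases gap gap′
  ... | inj₁ pi+l′d≡pi′+ld
    with refl , refl ←
           p*x+a*d-injective p-prime p∤d (<-trans l′<J J<p) (<-trans l<J J<p) pi+l′d≡pi′+ld
    = refl
  ... | inj₂ pi+pi′≡ld+l′d =
    contradiction (subst (p ∣_) p[i+i′]≡[l+l′]d (m∣m*n (i + i′)))
                  (p∤*d p-prime p∤d l+l′>0 l+l′<p)
    where
    p[i+i′]≡[l+l′]d : p * (i + i′) ≡ (l + l′) * d
    p[i+i′]≡[l+l′]d =
      trans (*-distribˡ-+ p i i′) (trans pi+pi′≡ld+l′d (sym (*-distribʳ-+ d l l′)))
    l+l′>0 : 0 < l + l′
    l+l′>0 = <-≤-trans l>0 (m≤m+n l l′)
    l+l′<p : l + l′ < p
    l+l′<p = subst (l + l′ <_) J+j≡p (+-mono-<-≤ l<J (≤-pred (≤-trans l′<J J≤1+j)))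

  private
    instance
      p-nonZero : NonZero p
      p-nonZero = prime⇒nonZero p-prime

    residue-preimage : suc j ≤ J → ∀ {k l q} → p * k < j * d → ¬ p ∣ k →
                       l < p → k + l * d ≡ q * p →
                       ∃[ x ] proj₁ x ≤ d × RJ-Condition x × Offset x k
    residue-preimage 1+j≤J {k} {l} {q} pk<jd p∤k l<p k+ld≡qp = by-cases (l <? J)
      where
      open ≤-Reasoning
      k+ld≡pq : k + l * d ≡ p * q
      k+ld≡pq = trans k+ld≡qp (*-comm q p)

      l>0 : 0 < l
      l>0 = n≢0⇒n>0 λ { refl → p∤k (divides q (trans (sym (+-identityʳ k)) k+ld≡qp)) }

      q<d : q < d
      q<d = *-cancelˡ-< p q d (begin-strict
        p * q     ≡⟨ k+ld≡pq ⟨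
        k + l * d <⟨ +-monoˡ-< (l * d) (p*k<[p∸J]*d⇒k<d pk<jd) ⟩
        suc l * d ≤⟨ *-monoˡ-≤ d l<p ⟩
        p * d     ∎)

      by-cases : Dec (l < J) → ∃[ x ] proj₁ x ≤ d × RJ-Condition x × Offset x k
      by-cases (yes l<J) =
        (q , l) , <⇒≤ q<d ,
        (l>0 , l<J , above-lowerEnd l>0 k+ld≡pq ,
         Equivalence.from (above-upperEnd⇔ {l = l} k+ld≡pq) pk<jd) ,
        inj₁ k+ld≡pq
      by-cases (no l≮J) =
        (d ∸ q , p ∸ l) , m∸n≤m d q ,
        (p∸l>0 , p∸l<J , Equivalence.from (below-lowerEnd⇔ p∸l>0 reflected) pk+d<Jd ,
         below-upperEnd {l = p ∸ l} reflected) ,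
        inj₂ reflected
        where
        reflected : k + p * (d ∸ q) ≡ (p ∸ l) * d
        reflected = k+ld≡pq⇒k+p[d∸q]≡[p∸l]d (<⇒≤ l<p) (<⇒≤ q<d) k+ld≡pq
        p∸l>0 : 0 < p ∸ l
        p∸l>0 = m<n⇒0<n∸m l<p
        p∸l<J : p ∸ l < J
        p∸l<J = <-≤-trans (s≤s (∸-monoʳ-≤ p (≮⇒≥ l≮J))) 1+j≤J
        pk+d<Jd : p * k + d < J * d
        pk+d<Jd = begin-strict
          p * k + d <⟨ +-monoˡ-< d pk<jd ⟩
          j * d + d ≡⟨ +-comm (j * d) d ⟩
          suc j * d ≤⟨ *-monoˡ-≤ d 1+j≤J ⟩
          J * d     ∎

  offset-surjective : suc j ≤ J → ∀ {k} → CJ-Condition k →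
                      ∃[ x ] proj₁ x ≤ d × RJ-Condition x × Offset x k
  offset-surjective 1+j≤J {k} (_ , pk<jd , p∤k)
    with l , l<p , divides q k+ld≡qp ← ∃-residue (prime∧∤⇒coprime p-prime p∤d) k
    = residue-preimage 1+j≤J {q = q} pk<jd p∤k l<p k+ld≡qp

proposition3p2 : (p d J : ℕ) → Prime p → ¬ (2 ∣ p) → 0 < d → ¬ (p ∣ d) → 1 < J → J < p →
    ((2 * J ≤ p + 1 → length (RJ p d J) ≤ length (CJ p d J))
     × (p + 1 ≤ 2 * J → length (CJ p d J) ≤ length (RJ p d J)))
proposition3p2 p d J p-prime _ d>0 p∤d 1<J J<p = R≤C , C≤R
  where
  open Conditions p d J
  open OffsetMap p-prime d>0 p∤d 1<J J<p

  R≤C : 2 * J ≤ p + 1 → length (RJ p d J) ≤ length (CJ p d J)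
  R≤C 2J≤p+1 = injection⇒length≤ Offset RJ-unique
    (λ {(i , l)} x∈RJ → ∣ p * i - l * d ∣ ,
       ∈CJ⁺ (offset-CJ-Condition J≤1+j (∈RJ⁻ x∈RJ) (gap-∣-∣ _ _)) , gap-∣-∣ _ _)
    (λ x∈RJ x′∈RJ → offset-injective J≤1+j (∈RJ⁻ x∈RJ) (∈RJ⁻ x′∈RJ))
    where
    J≤1+j : J ≤ suc j
    J≤1+j = 2J≤p+1⇒J≤1+j 2J≤p+1

  C≤R : p + 1 ≤ 2 * J → length (CJ p d J) ≤ length (RJ p d J)
  C≤R p+1≤2J = injection⇒length≤ (flip Offset) CJ-unique
    (λ k∈CJ → let x , i≤d , cond , gap = offset-surjective 1+j≤J (∈CJ⁻ k∈CJ)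
              in x , ∈RJ⁺ i≤d cond , gap)
    (λ _ _ → gap-functional)
    where
    1+j≤J : suc j ≤ J
    1+j≤J = p+1≤2J⇒1+j≤J p+1≤2J
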